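{- Let $k$ be a field and let $A$ be an $n$-dimensional (associative) $k$-algebra. Let $S\subseteq A$ be a subset which is closed under multiplication (a subsemigroup of $(A,\cdot)$) and which spans $A$ as a $k$-vector space. Suppose there exist characters $\chi_1,\dots,\chi_n$ of $S$ (maps $\chi_i\colon S\to k$ with $\chi_i(st)=\chi_i(s)\chi_i(t)$ for all $s,t\in S$) and elements $e_1,\dots,e_n\in A$ such that for every $s\in S$ \[ s=\sum_{i=1}^n \chi_i(s)\,e_i . \] Then $e_1,\dots,e_n$ is a basis of $A$, and the linear map $A\to k^n$, $\sum_i a_ie_i\mapsto(a_1,\dots,a_n)$, is an isomorphism of $k$-algebras; in particular $A\cong k^n$ with $e_1,\dots,e_n$ as its primitive idempotents. Moreover each $\chi_i$ extends to a character (algebra homomorphism) $A\to k$. -}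

module Defs where

open import Level using (Level; _⊔_; suc)
open import Data.Nat.Base using (ℕ)
open import Data.Fin.Base using (Fin)
open import Data.Product using (Σ; Σ-syntax; _×_; _,_; proj₁; proj₂; ∃)
open import Relation.Nullary using (¬_)
open import Relation.Unary using (Pred)
open import Algebra.Bundles using (CommutativeRing; Ring)
import Algebra.Definitions.RawMonoid as RawMonoidDefs

record Field (c ℓ : Level) : Set (suc (c ⊔ ℓ)) where
  field
    commutativeRing : CommutativeRing c ℓ
  open CommutativeRing commutativeRing public
  field
    1≉0     : ¬ (1# ≈ 0#)
    inverse : ∀ x → ¬ (x ≈ 0#) → Σ[ y ∈ Carrier ] (x * y ≈ 1#)

record Algebra {c ℓ} (F : Field c ℓ) (a ℓa : Level) : Set (suc (c ⊔ ℓ ⊔ a ⊔ ℓa)) where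
  module K = Field F
  field
    ring : Ring a ℓa
  open Ring ring public
  infixr 7 _·_
  field
    _·_          : K.Carrier → Carrier → Carrier
    ·-cong       : ∀ {λ₁ λ₂ x y} → λ₁ K.≈ λ₂ → x ≈ y → λ₁ · x ≈ λ₂ · y
    ·-distrib-+  : ∀ λ₁ x y → λ₁ · (x + y) ≈ λ₁ · x + λ₁ · y
    +-distrib-·  : ∀ λ₁ λ₂ x → (λ₁ K.+ λ₂) · x ≈ λ₁ · x + λ₂ · x
    ·-assoc      : ∀ λ₁ λ₂ x → (λ₁ K.* λ₂) · x ≈ λ₁ · (λ₂ · x)
    ·-identity   : ∀ x → K.1# · x ≈ x
    ·-*-assocˡ   : ∀ λ₁ x y → (λ₁ · x) * y ≈ λ₁ · (x * y)
    ·-*-assocʳ   : ∀ λ₁ x y → x * (λ₁ · y) ≈ λ₁ · (x * y)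

module AlgebraNotions {c ℓ a ℓa} {F : Field c ℓ} (A : Algebra F a ℓa) where
  open Algebra A
  open RawMonoidDefs +-rawMonoid using (sum)

  lincomb : ∀ {m} → (Fin m → K.Carrier) → (Fin m → Carrier) → Carrier
  lincomb c v = sum (λ i → c i · v i)

  LinearlyIndependent : ∀ {m} → (Fin m → Carrier) → Set (c ⊔ ℓ ⊔ ℓa)
  LinearlyIndependent v = ∀ coeff → lincomb coeff v ≈ 0# → ∀ i → coeff i K.≈ K.0#

  Generates : ∀ {m} → (Fin m → Carrier) → Set (c ⊔ a ⊔ ℓa)
  Generates {m} v = ∀ x → Σ[ coeff ∈ (Fin m → K.Carrier) ] (x ≈ lincomb coeff v)

  IsBasis : ∀ {m} → (Fin m → Carrier) → Set (c ⊔ ℓ ⊔ a ⊔ ℓa)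
  IsBasis v = LinearlyIndependent v × Generates v

  HasDimension : ℕ → Set (c ⊔ ℓ ⊔ a ⊔ ℓa)
  HasDimension n = Σ[ v ∈ (Fin n → Carrier) ] IsBasis v

  Spans : ∀ {p} → Pred Carrier p → Set (c ⊔ a ⊔ ℓa ⊔ p)
  Spans S = ∀ x → Σ[ m ∈ ℕ ] Σ[ coeff ∈ (Fin m → K.Carrier) ] Σ[ s ∈ (Fin m → Carrier) ]
              ((∀ j → S (s j)) × (x ≈ lincomb coeff s))

  MulClosed : ∀ {p} → Pred Carrier p → Set (a ⊔ p)
  MulClosed S = ∀ {x y} → S x → S y → S (x * y)

  IsCharacterOf : ∀ {p} (S : Pred Carrier p) → MulClosed S →
                  (Σ Carrier S → K.Carrier) → Set (a ⊔ p ⊔ ℓ)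
  IsCharacterOf S closed χ = ∀ (s t : Σ Carrier S) →
    χ (proj₁ s * proj₁ t , closed (proj₂ s) (proj₂ t)) K.≈ χ s K.* χ t

  record IsAlgebraHomToK (ψ : Carrier → K.Carrier) : Set (c ⊔ ℓ ⊔ a ⊔ ℓa) where
    field
      cong   : ∀ {x y} → x ≈ y → ψ x K.≈ ψ y
      +-hom  : ∀ x y → ψ (x + y) K.≈ ψ x K.+ ψ y
      ·-hom  : ∀ λ₁ x → ψ (λ₁ · x) K.≈ λ₁ K.* ψ x
      *-hom  : ∀ x y → ψ (x * y) K.≈ ψ x K.* ψ y
      1-hom  : ψ 1# K.≈ K.1#

  -- a k-algebra homomorphism A → k^n (k^n with pointwise operations):
  -- exactly that every coordinate is an algebra homomorphism A → k
  IsAlgebraHomToKⁿ : ∀ {n} → (Carrier → Fin n → K.Carrier) → Set (c ⊔ ℓ ⊔ a ⊔ ℓa)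
  IsAlgebraHomToKⁿ φ = ∀ i → IsAlgebraHomToK (λ x → φ x i)

  InjectiveKⁿ : ∀ {n} → (Carrier → Fin n → K.Carrier) → Set (ℓ ⊔ a ⊔ ℓa)
  InjectiveKⁿ φ = ∀ x y → (∀ i → φ x i K.≈ φ y i) → x ≈ y

{-# OPTIONS --safe #-}
-- Since S spans A, so do e₁, …, eₙ, and transporting coordinates along a basis gives linear
-- functionals φᵢ with x = Σ φᵢ(x) eᵢ. The rows of δ − Q, where Qⱼᵢ = φᵢ(eⱼ), are relations among the eᵢ.
-- A spanning family of size dim A admits no nontrivial relation, but as equality in F need not be
-- decidable this only shows that Q is not-not the identity; since (δ − Q) Q = 0, Gaussian elimination
-- (a pivot not-not equal to 1 is nonzero, hence invertible) yields Q = δ, so the φᵢ recover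
-- coefficients. Each φᵢ agrees with the character χᵢ on S, hence is multiplicative on S and, S spanning
-- A, on all of A; finally φᵢ(1) = φᵢ(1) φᵢ(eᵢ) = φᵢ(eᵢ) = 1.
module Submission where

open import Defs
open import Level using (Level; _⊔_)
open import Data.Nat.Base using (ℕ; zero; suc; _<_; s≤s)
open import Data.Nat.Properties using (n<1+n)
open import Data.Fin.Base using (Fin; zero; suc; punchIn)
open import Data.Fin.Properties using (suc-injective; punchInᵢ≢i) renaming (_≟_ to _≟ᶠ_)
open import Data.Vec.Functional using (Vector; removeAt)
open import Data.Product using (Σ; Σ-syntax; ∃; _×_; _,_; proj₁; proj₂)
open import Data.Empty using (⊥-elim)
open import Function using (_∘_)
open import Relation.Nullary using (¬_; Dec; yes; no)
open import Relation.Nullary.Negation using (¬¬-map)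
open import Relation.Binary.PropositionalEquality as ≡ using (_≡_; _≢_)
open import Relation.Unary using (Pred)
import Algebra.Properties.Ring as RingProperties
import Algebra.Properties.CommutativeMonoid.Sum as Sum

¬¬-∀ : ∀ {n p} {P : Fin n → Set p} → (∀ i → ¬ ¬ P i) → ¬ ¬ (∀ i → P i)
¬¬-∀ {zero}  _ k = k λ ()
¬¬-∀ {suc n} h k = h zero λ p₀ → ¬¬-∀ (h ∘ suc) λ pₛ → k λ { zero → p₀ ; (suc i) → pₛ i }

¬∀⇒¬¬∃¬ : ∀ {n p} {P : Fin n → Set p} → ¬ (∀ i → P i) → ¬ ¬ (∃ λ i → ¬ P i)
¬∀⇒¬¬∃¬ ¬∀P ¬∃¬P = ¬¬-∀ (λ i ¬Pi → ¬∃¬P (i , ¬Pi)) ¬∀P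

module Matrices {c ℓ} (F : Field c ℓ) where
  open Field F hiding (zero)
  open RingProperties ring using (-‿distribˡ-*; [y-z]x≈yx-zx; -0#≈0#)
  open import Algebra.Properties.Semiring.Sum semiring using (*-distribˡ-sum)
  open Sum +-commutativeMonoid using (sum; sum-remove; sum-cong-≋; sum-replicate-zero; ∑-distrib-+)
  open import Relation.Binary.Reasoning.Setoid setoid

  Matrix : ℕ → ℕ → Set c
  Matrix m n = Fin m → Fin n → Carrier

  δ : ∀ {n} → Matrix n n
  δ i j with i ≟ᶠ j
  ... | yes _ = 1#
  ... | no  _ = 0#

  δ-diagonal : ∀ {n} (i : Fin n) → δ i i ≈ 1#
  δ-diagonal i with i ≟ᶠ i
  ... | yes _ = refl
  ... | no i≢i = ⊥-elim (i≢i ≡.refl)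

  δ-offDiagonal : ∀ {n} {i j : Fin n} → i ≢ j → δ i j ≈ 0#
  δ-offDiagonal {i = i} {j} i≢j with i ≟ᶠ j
  ... | yes i≡j = ⊥-elim (i≢j i≡j)
  ... | no  _   = refl

  δ-sym : ∀ {n} (i j : Fin n) → δ i j ≈ δ j i
  δ-sym i j with i ≟ᶠ j
  ... | yes ≡.refl = sym (δ-diagonal i)
  ... | no  i≢j  = sym (δ-offDiagonal (i≢j ∘ ≡.sym))

  δ-suc : ∀ {n} (i j : Fin n) → δ (suc i) (suc j) ≈ δ i j
  δ-suc i j = by-cases (i ≟ᶠ j)
    where
      by-cases : Dec (i ≡ j) → δ (suc i) (suc j) ≈ δ i j
      by-cases (yes ≡.refl) = trans (δ-diagonal (suc i)) (sym (δ-diagonal i))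
      by-cases (no i≢j)     = trans (δ-offDiagonal (i≢j ∘ suc-injective)) (sym (δ-offDiagonal i≢j))

  dot : ∀ {n} → Vector Carrier n → Vector Carrier n → Carrier
  dot x y = sum (λ i → x i * y i)

  _⊗_ : ∀ {m n p} → Matrix m n → Matrix n p → Matrix m p
  (X ⊗ Y) i k = dot (X i) (λ j → Y j k)

  IsIdentity : ∀ {n} → Matrix n n → Set ℓ
  IsIdentity P = ∀ i j → P i j ≈ δ i j

  y≈0⇒x-y≈x : ∀ {x y} → y ≈ 0# → x - y ≈ x
  y≈0⇒x-y≈x {x} y≈0 = trans (+-congˡ (trans (-‿cong y≈0) -0#≈0#)) (+-identityʳ x)

  x*y≈0⇒x≈0 : ∀ {x y y⁻¹} → y * y⁻¹ ≈ 1# → x * y ≈ 0# → x ≈ 0#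
  x*y≈0⇒x≈0 {x} {y} {y⁻¹} y*y⁻¹≈1 xy≈0 = begin
    x              ≈⟨ *-identityʳ x ⟨
    x * 1#         ≈⟨ *-congˡ y*y⁻¹≈1 ⟨
    x * (y * y⁻¹)  ≈⟨ *-assoc x y y⁻¹ ⟨
    x * y * y⁻¹    ≈⟨ *-congʳ xy≈0 ⟩
    0# * y⁻¹       ≈⟨ zeroˡ y⁻¹ ⟩
    0#             ∎

  sum-zero : ∀ {n} (f : Vector Carrier n) → (∀ i → f i ≈ 0#) → sum f ≈ 0#
  sum-zero {n} _ f≈0 = trans (sum-cong-≋ f≈0) (sum-replicate-zero n)

  dot-comm : ∀ {n} (x y : Vector Carrier n) → dot x y ≈ dot y x
  dot-comm x y = sum-cong-≋ (λ i → *-comm (x i) (y i))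

  dot-δ : ∀ {n} (x : Vector Carrier n) j → dot x (δ j) ≈ x j
  dot-δ {suc n} x j = begin
    dot x (δ j)                                          ≈⟨ sum-remove {i = j} (λ k → x k * δ j k) ⟩
    x j * δ j j + dot (removeAt x j) (removeAt (δ j) j)  ≈⟨ +-cong x*1≈x off-diagonal≈0 ⟩
    x j + 0#                                             ≈⟨ +-identityʳ (x j) ⟩
    x j                                                  ∎
    where
      x*1≈x = trans (*-congˡ (δ-diagonal j)) (*-identityʳ (x j))
      off-diagonal≈0 = sum-zero _ λ k → trans (*-congˡ (δ-offDiagonal (punchInᵢ≢i j k ∘ ≡.sym))) (zeroʳ _)

  dot-removeAt : ∀ {n} (x y : Vector Carrier (suc n)) j → x j ≈ 0# →
                 dot (removeAt x j) (removeAt y j) ≈ dot x y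
  dot-removeAt x y j xⱼ≈0 = begin
    dot (removeAt x j) (removeAt y j)              ≈⟨ +-identityˡ _ ⟨
    0# + dot (removeAt x j) (removeAt y j)         ≈⟨ +-congʳ (trans (*-congʳ xⱼ≈0) (zeroˡ (y j))) ⟨
    x j * y j + dot (removeAt x j) (removeAt y j)  ≈⟨ sum-remove {i = j} (λ k → x k * y k) ⟨
    dot x y                                        ∎

  dot-subˡ : ∀ {n} (x r y : Vector Carrier n) μ → dot (λ k → x k - μ * r k) y ≈ dot x y - μ * dot r y
  dot-subˡ x r y μ = begin
    dot (λ k → x k - μ * r k) y               ≈⟨ sum-cong-≋ distribute ⟩
    sum (λ k → x k * y k + - μ * (r k * y k))  ≈⟨ ∑-distrib-+ (λ k → x k * y k) (λ k → - μ * (r k * y k)) ⟩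
    dot x y + sum (λ k → - μ * (r k * y k))    ≈⟨ +-congˡ (*-distribˡ-sum (- μ) (λ k → r k * y k)) ⟨
    dot x y + - μ * dot r y                    ≈⟨ +-congˡ (-‿distribˡ-* μ _) ⟨
    dot x y - μ * dot r y                      ∎
    where
      distribute : ∀ k → (x k - μ * r k) * y k ≈ x k * y k + - μ * (r k * y k)
      distribute k = trans ([y-z]x≈yx-zx (y k) (x k) (μ * r k))
        (+-congˡ (trans (-‿cong (*-assoc μ (r k) (y k))) (-‿distribˡ-* μ _)))

  eliminate : ∀ {n} → Vector Carrier (suc n) → Fin (suc n) → Carrier →
              Vector Carrier (suc n) → Vector Carrier n
  eliminate r j rⱼ⁻¹ x = removeAt (λ k → x k - x j * rⱼ⁻¹ * r k) j

  dot-eliminate : ∀ {n} {r : Vector Carrier (suc n)} {j rⱼ⁻¹} → r j * rⱼ⁻¹ ≈ 1# →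
                  (x y : Vector Carrier (suc n)) → dot r y ≈ 0# →
                  dot (eliminate r j rⱼ⁻¹ x) (removeAt y j) ≈ dot x y
  dot-eliminate {r = r} {j} {rⱼ⁻¹} rⱼ*rⱼ⁻¹≈1 x y ry≈0 = begin
    dot (eliminate r j rⱼ⁻¹ x) (removeAt y j)  ≈⟨ dot-removeAt (λ k → x k - μ * r k) y j pivot-cleared ⟩
    dot (λ k → x k - μ * r k) y                ≈⟨ dot-subˡ x r y μ ⟩
    dot x y - μ * dot r y                      ≈⟨ y≈0⇒x-y≈x (trans (*-congˡ ry≈0) (zeroʳ μ)) ⟩
    dot x y                                    ∎
    where
      μ = x j * rⱼ⁻¹
      pivot-cleared : x j - μ * r j ≈ 0#
      pivot-cleared = begin
        x j - x j * rⱼ⁻¹ * r j    ≈⟨ +-congˡ (-‿cong (*-assoc (x j) rⱼ⁻¹ (r j))) ⟩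
        x j - x j * (rⱼ⁻¹ * r j)  ≈⟨ +-congˡ (-‿cong (*-congˡ (trans (*-comm rⱼ⁻¹ (r j)) rⱼ*rⱼ⁻¹≈1))) ⟩
        x j - x j * 1#            ≈⟨ +-congˡ (-‿cong (*-identityʳ (x j))) ⟩
        x j - x j                 ≈⟨ -‿inverseʳ (x j) ⟩
        0#                        ∎

  identity-does-not-factor : ∀ {n p} → p < n → (X : Matrix n p) (Y : Matrix p n) → ¬ IsIdentity (X ⊗ Y)
  identity-does-not-factor {suc n} {zero} _ X Y XY≈I =
    1≉0 (sym (XY≈I zero zero))
  identity-does-not-factor {suc n} {suc p} (s≤s p<n) X Y XY≈I = ¬∀⇒¬¬∃¬ row₀≉0 pivot
    where
      row₀≉0 : ¬ (∀ j → X zero j ≈ 0#)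
      row₀≉0 X₀≈0 = 1≉0 (trans (sym (XY≈I zero zero))
        (sum-zero (λ j → X zero j * Y j zero) λ j → trans (*-congʳ (X₀≈0 j)) (zeroˡ _)))

      -- clear column j using row 0 as pivot row, then drop row 0 and column j
      pivot : ¬ (∃ λ j → ¬ X zero j ≈ 0#)
      pivot (j , X₀ⱼ≉0) = identity-does-not-factor p<n X′ Y′ X′Y′≈I
        where
          X₀ⱼ⁻¹ = proj₁ (inverse (X zero j) X₀ⱼ≉0)
          X′ : Matrix n p
          X′ i = eliminate (X zero) j X₀ⱼ⁻¹ (X (suc i))
          Y′ : Matrix p n
          Y′ k l = Y (punchIn j k) (suc l)
          X′Y′≈I : IsIdentity (X′ ⊗ Y′)
          X′Y′≈I i l = begin
            (X′ ⊗ Y′) i l                    ≈⟨ dot-eliminate {r = X zero} (proj₂ (inverse (X zero j) X₀ⱼ≉0))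
                                                  (X (suc i)) (λ k → Y k (suc l)) (XY≈I zero (suc l)) ⟩
            (X ⊗ Y) (suc i) (suc l)          ≈⟨ XY≈I (suc i) (suc l) ⟩
            δ (suc i) (suc l)                ≈⟨ δ-suc i l ⟩
            δ i l                            ∎

  ¬¬identity⇒injective : ∀ {n} (P : Matrix n n) → ¬ ¬ IsIdentity P →
                         (x : Vector Carrier n) → (∀ k → dot x (λ j → P j k) ≈ 0#) → ∀ j → x j ≈ 0#
  ¬¬identity⇒injective {suc n} P ¬¬P≈I x xP≈0 = x≈0
    where
      column : Fin (suc n) → Vector Carrier (suc n)
      column k j = P j k

      P₀₀≉0 : ¬ P zero zero ≈ 0#
      P₀₀≉0 P₀₀≈0 = ¬¬P≈I λ P≈I → 1≉0 (trans (sym (P≈I zero zero)) P₀₀≈0)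

      P₀₀⁻¹ = proj₁ (inverse (P zero zero) P₀₀≉0)
      P₀₀*P₀₀⁻¹≈1 = proj₂ (inverse (P zero zero) P₀₀≉0)

      P′ : Matrix n n
      P′ j k = eliminate (column zero) zero P₀₀⁻¹ (column (suc k)) j

      P′≈I : IsIdentity P → IsIdentity P′
      P′≈I P≈I j k = trans (+-cong (P≈I (suc j) (suc k)) (-‿cong P₀ₖ-term≈0)) (trans (y≈0⇒x-y≈x refl) (δ-suc j k))
        where
          P₀ₖ-term≈0 : P zero (suc k) * P₀₀⁻¹ * P (suc j) zero ≈ 0#
          P₀ₖ-term≈0 = trans (*-congˡ (P≈I (suc j) zero)) (zeroʳ _)

      xP′≈0 : ∀ k → dot (x ∘ suc) (λ j → P′ j k) ≈ 0#
      xP′≈0 k = begin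
        dot (x ∘ suc) (λ j → P′ j k)                ≈⟨ dot-comm (x ∘ suc) (λ j → P′ j k) ⟩
        dot (λ j → P′ j k) (removeAt x zero)        ≈⟨ dot-eliminate {r = column zero} P₀₀*P₀₀⁻¹≈1 (column (suc k)) x
                                                        (trans (dot-comm (column zero) x) (xP≈0 zero)) ⟩
        dot (column (suc k)) x                      ≈⟨ dot-comm (column (suc k)) x ⟩
        dot x (column (suc k))                      ≈⟨ xP≈0 (suc k) ⟩
        0#                                          ∎

      xₛ≈0 : ∀ j → x (suc j) ≈ 0#
      xₛ≈0 = ¬¬identity⇒injective P′ (¬¬-map P′≈I ¬¬P≈I) (x ∘ suc) xP′≈0

      x₀≈0 : x zero ≈ 0#
      x₀≈0 = x*y≈0⇒x≈0 P₀₀*P₀₀⁻¹≈1 (begin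
        x zero * P zero zero                       ≈⟨ +-identityʳ _ ⟨
        x zero * P zero zero + 0#                  ≈⟨ +-congˡ (sum-zero _ λ j → trans (*-congʳ (xₛ≈0 j)) (zeroˡ _)) ⟨
        dot x (column zero)                        ≈⟨ xP≈0 zero ⟩
        0#                                         ∎)

      x≈0 : ∀ j → x j ≈ 0#
      x≈0 zero    = x₀≈0
      x≈0 (suc j) = xₛ≈0 j

module LinearAlgebra {c ℓ a ℓa} {F : Field c ℓ} (A : Algebra F a ℓa) where
  open Algebra A hiding (zero)
  open AlgebraNotions A
  open Matrices F using (Matrix; δ; δ-diagonal; δ-offDiagonal; δ-sym; dot; dot-δ; _⊗_; IsIdentity;
                         identity-does-not-factor; ¬¬identity⇒injective)
  open RingProperties ring using (x+x≈x⇒x≈0; +-inverseʳ-unique; +-inverseˡ-unique; x≈y⇒x∙y⁻¹≈ε)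
  module KP = RingProperties K.ring
  open import Algebra.Properties.CommutativeSemigroup +-commutativeSemigroup using (interchange)
  open Sum +-commutativeMonoid using (sum-remove)
  module ΣK = Sum K.+-commutativeMonoid
  open import Algebra.Properties.Semiring.Sum K.semiring using (*-distribˡ-sum)
  open import Relation.Binary.Reasoning.Setoid setoid

  ·-zeroʳ : ∀ k → k · 0# ≈ 0#
  ·-zeroʳ k = x+x≈x⇒x≈0 _ (trans (sym (·-distrib-+ k 0# 0#)) (·-cong K.refl (+-identityʳ 0#)))

  ·-zeroˡ : ∀ x → K.0# · x ≈ 0#
  ·-zeroˡ x = x+x≈x⇒x≈0 _ (trans (sym (+-distrib-· K.0# K.0# x)) (·-cong (K.+-identityʳ K.0#) refl))

  ·-negˡ : ∀ k x → (K.- k) · x ≈ - (k · x)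
  ·-negˡ k x = +-inverseʳ-unique (k · x) ((K.- k) · x)
    (trans (sym (+-distrib-· k (K.- k) x)) (trans (·-cong (K.-‿inverseʳ k) refl) (·-zeroˡ x)))

  ·-negʳ : ∀ k x → k · (- x) ≈ - (k · x)
  ·-negʳ k x = +-inverseʳ-unique (k · x) (k · (- x))
    (trans (sym (·-distrib-+ k x (- x))) (trans (·-cong K.refl (-‿inverseʳ x)) (·-zeroʳ k)))

  lincomb-cong : ∀ {m} {c d : Fin m → K.Carrier} {w u : Fin m → Carrier} →
                 (∀ i → c i K.≈ d i) → (∀ i → w i ≈ u i) → lincomb c w ≈ lincomb d u
  lincomb-cong {zero}  c≈d w≈u = refl
  lincomb-cong {suc m} c≈d w≈u = +-cong (·-cong (c≈d zero) (w≈u zero)) (lincomb-cong (c≈d ∘ suc) (w≈u ∘ suc))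

  lincomb-zero : ∀ {m} {c : Fin m → K.Carrier} (w : Fin m → Carrier) → (∀ i → c i K.≈ K.0#) → lincomb c w ≈ 0#
  lincomb-zero {zero}  w c≈0 = refl
  lincomb-zero {suc m} w c≈0 =
    trans (+-cong (trans (·-cong (c≈0 zero) refl) (·-zeroˡ (w zero))) (lincomb-zero (w ∘ suc) (c≈0 ∘ suc)))
          (+-identityʳ 0#)

  lincomb-+ : ∀ {m} (c d : Fin m → K.Carrier) (w : Fin m → Carrier) →
              lincomb c w + lincomb d w ≈ lincomb (λ i → c i K.+ d i) w
  lincomb-+ {zero}  c d w = +-identityʳ 0#
  lincomb-+ {suc m} c d w = trans (interchange _ _ _ _)
    (+-cong (sym (+-distrib-· (c zero) (d zero) (w zero))) (lincomb-+ (c ∘ suc) (d ∘ suc) (w ∘ suc)))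

  lincomb-scale : ∀ {m} k (c : Fin m → K.Carrier) (w : Fin m → Carrier) →
                  k · lincomb c w ≈ lincomb (λ i → k K.* c i) w
  lincomb-scale {zero}  k c w = ·-zeroʳ k
  lincomb-scale {suc m} k c w = trans (·-distrib-+ k _ _)
    (+-cong (sym (·-assoc k (c zero) (w zero))) (lincomb-scale k (c ∘ suc) (w ∘ suc)))

  lincomb-sub : ∀ {m} (c d : Fin m → K.Carrier) (w : Fin m → Carrier) →
                lincomb c w - lincomb d w ≈ lincomb (λ i → c i K.- d i) w
  lincomb-sub c d w = trans (+-congˡ (sym lincomb-neg)) (lincomb-+ c (λ i → K.- d i) w)
    where
      lincomb-neg : lincomb (λ i → K.- d i) w ≈ - lincomb d w
      lincomb-neg = +-inverseʳ-unique (lincomb d w) _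
        (trans (lincomb-+ d (λ i → K.- d i) w) (lincomb-zero w (λ i → K.-‿inverseʳ (d i))))

  lincomb-lincomb : ∀ {m n} (α : Fin m → K.Carrier) (C : Fin m → Fin n → K.Carrier) (w : Fin n → Carrier) →
                    lincomb α (λ l → lincomb (C l) w) ≈ lincomb (λ i → dot α (λ l → C l i)) w
  lincomb-lincomb {zero}  α C w = sym (lincomb-zero w (λ i → K.refl))
  lincomb-lincomb {suc m} α C w =
    trans (+-cong (lincomb-scale (α zero) (C zero) w) (lincomb-lincomb (α ∘ suc) (C ∘ suc) w)) (lincomb-+ _ _ w)

  lincomb-remove : ∀ {m} (c : Fin (suc m) → K.Carrier) (w : Fin (suc m) → Carrier) j →
                   lincomb c w ≈ c j · w j + lincomb (removeAt c j) (removeAt w j)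
  lincomb-remove c w j = sum-remove {i = j} (λ i → c i · w i)

  lincomb-δ : ∀ {m} (l : Fin m) (w : Fin m → Carrier) → lincomb (δ l) w ≈ w l
  lincomb-δ {suc m} l w = begin
    lincomb (δ l) w                                             ≈⟨ lincomb-remove (δ l) w l ⟩
    δ l l · w l + lincomb (removeAt (δ l) l) (removeAt w l)     ≈⟨ +-cong 1·wₗ≈wₗ off-diagonal≈0 ⟩
    w l + 0#                                                    ≈⟨ +-identityʳ (w l) ⟩
    w l                                                         ∎
    where
      1·wₗ≈wₗ = trans (·-cong (δ-diagonal l) refl) (·-identity (w l))
      off-diagonal≈0 = lincomb-zero (removeAt w l) (λ i → δ-offDiagonal (punchInᵢ≢i l i ∘ ≡.sym))

  record IsLinear (f : Carrier → K.Carrier) : Set (c ⊔ ℓ ⊔ a ⊔ ℓa) where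
    field
      cong  : ∀ {x y} → x ≈ y → f x K.≈ f y
      +-hom : ∀ x y → f (x + y) K.≈ f x K.+ f y
      ·-hom : ∀ k x → f (k · x) K.≈ k K.* f x

    linear-0 : f 0# K.≈ K.0#
    linear-0 = K.trans (cong (sym (·-zeroˡ 0#))) (K.trans (·-hom K.0# 0#) (K.zeroˡ _))

    linear-lincomb : ∀ {m} (c : Fin m → K.Carrier) (w : Fin m → Carrier) → f (lincomb c w) K.≈ dot c (f ∘ w)
    linear-lincomb {zero}  c w = linear-0
    linear-lincomb {suc m} c w = K.trans (+-hom _ _) (K.+-cong (·-hom _ _) (linear-lincomb (c ∘ suc) (w ∘ suc)))

  open IsLinear

  linear-*ʳ : ∀ {f} → IsLinear f → ∀ k → IsLinear (λ x → f x K.* k)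
  linear-*ʳ f-linear k = record
    { cong  = λ x≈y → K.*-congʳ (cong f-linear x≈y)
    ; +-hom = λ x y → K.trans (K.*-congʳ (+-hom f-linear x y)) (K.distribʳ k _ _)
    ; ·-hom = λ l x → K.trans (K.*-congʳ (·-hom f-linear l x)) (K.*-assoc _ _ _)
    }

  linear-∘-*ʳ : ∀ {f} → IsLinear f → ∀ t → IsLinear (λ x → f (x * t))
  linear-∘-*ʳ f-linear t = record
    { cong  = λ x≈y → cong f-linear (*-congʳ x≈y)
    ; +-hom = λ x y → K.trans (cong f-linear (distribʳ t x y)) (+-hom f-linear _ _)
    ; ·-hom = λ k x → K.trans (cong f-linear (·-*-assocˡ k x t)) (·-hom f-linear _ _)
    }

  linear-∘-*ˡ : ∀ {f} → IsLinear f → ∀ t → IsLinear (λ y → f (t * y))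
  linear-∘-*ˡ f-linear t = record
    { cong  = λ x≈y → cong f-linear (*-congˡ x≈y)
    ; +-hom = λ x y → K.trans (cong f-linear (distribˡ t x y)) (+-hom f-linear _ _)
    ; ·-hom = λ k y → K.trans (cong f-linear (·-*-assocʳ k t y)) (·-hom f-linear _ _)
    }

  dot-linear : ∀ {m} (f : Fin m → Carrier → K.Carrier) → (∀ k → IsLinear (f k)) →
               (b : Fin m → K.Carrier) → IsLinear (λ x → dot (λ k → f k x) b)
  dot-linear f f-linear b = record
    { cong  = λ x≈y → ΣK.sum-cong-≋ λ k → K.*-congʳ (cong (f-linear k) x≈y)
    ; +-hom = λ x y → K.trans (ΣK.sum-cong-≋ λ k → K.trans (K.*-congʳ (+-hom (f-linear k) x y)) (K.distribʳ (b k) _ _))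
                              (ΣK.∑-distrib-+ (λ k → f k x K.* b k) (λ k → f k y K.* b k))
    ; ·-hom = λ l x → K.trans (ΣK.sum-cong-≋ λ k → K.trans (K.*-congʳ (·-hom (f-linear k) l x)) (K.*-assoc _ _ _))
                              (K.sym (*-distribˡ-sum l (λ k → f k x K.* b k)))
    }

  record Coordinates {m} (w : Fin m → Carrier) : Set (c ⊔ ℓ ⊔ a ⊔ ℓa) where
    field
      coord        : Carrier → Fin m → K.Carrier
      coord-linear : ∀ i → IsLinear (λ x → coord x i)
      expand       : ∀ x → x ≈ lincomb (coord x) w

    coord-injective : InjectiveKⁿ coord
    coord-injective x y coord-x≈coord-y =
      trans (expand x) (trans (lincomb-cong coord-x≈coord-y (λ _ → refl)) (sym (expand y)))

  independent⇒lincomb-injective : ∀ {m} {w : Fin m → Carrier} → LinearlyIndependent w →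
                                  ∀ {c d} → lincomb c w ≈ lincomb d w → ∀ i → c i K.≈ d i
  independent⇒lincomb-injective {w = w} w-indep {c} {d} cw≈dw i =
    KP.x∙y⁻¹≈ε⇒x≈y _ _ (w-indep (λ i → c i K.- d i) (trans (sym (lincomb-sub c d w)) (x≈y⇒x∙y⁻¹≈ε cw≈dw)) i)

  basis⇒coordinates : ∀ {m} {v : Fin m → Carrier} → IsBasis v → Coordinates v
  basis⇒coordinates {v = v} (v-indep , v-gen) = record
    { coord        = coord
    ; coord-linear = λ i → record
      { cong  = λ {x} {y} x≈y → unique (trans (sym (expand x)) (trans x≈y (expand y))) i
      ; +-hom = λ x y → unique (begin
          lincomb (coord (x + y)) v                      ≈⟨ expand (x + y) ⟨
          x + y                                          ≈⟨ +-cong (expand x) (expand y) ⟩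
          lincomb (coord x) v + lincomb (coord y) v      ≈⟨ lincomb-+ (coord x) (coord y) v ⟩
          lincomb (λ i → coord x i K.+ coord y i) v      ∎) i
      ; ·-hom = λ k x → unique (begin
          lincomb (coord (k · x)) v                      ≈⟨ expand (k · x) ⟨
          k · x                                          ≈⟨ ·-cong K.refl (expand x) ⟩
          k · lincomb (coord x) v                        ≈⟨ lincomb-scale k (coord x) v ⟩
          lincomb (λ i → k K.* coord x i) v              ∎) i
      }
    ; expand       = expand
    }
    where
      coord : Carrier → Fin _ → K.Carrier
      coord x = proj₁ (v-gen x)
      expand : ∀ x → x ≈ lincomb (coord x) v
      expand x = proj₂ (v-gen x)
      unique = independent⇒lincomb-injective v-indep

  coordinates-of-generating : ∀ {m n} {v : Fin m → Carrier} {e : Fin n → Carrier} →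
                              Coordinates v → Generates e → Coordinates e
  coordinates-of-generating {v = v} {e} Cᵥ e-gen = record
    { coord        = λ x i → dot (coord x) (λ k → β k i)
    ; coord-linear = λ i → dot-linear (λ k x → coord x k) coord-linear (λ k → β k i)
    ; expand       = λ x → begin
        x                                              ≈⟨ expand x ⟩
        lincomb (coord x) v                            ≈⟨ lincomb-cong (λ _ → K.refl) (λ k → proj₂ (e-gen (v k))) ⟩
        lincomb (coord x) (λ k → lincomb (β k) e)      ≈⟨ lincomb-lincomb (coord x) β e ⟩
        lincomb (λ i → dot (coord x) (λ k → β k i)) e  ∎
    }
    where
      open Coordinates Cᵥ
      β : Fin _ → Fin _ → K.Carrier
      β k = proj₁ (e-gen (v k))

  no-smaller-generating-family : ∀ {n q} → HasDimension n → q < n → (w : Fin q → Carrier) → ¬ Generates w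
  no-smaller-generating-family {n} {q} (v , v-basis) q<n w w-gen = identity-does-not-factor q<n X Y XY≈I
    where
      open Coordinates (basis⇒coordinates v-basis)
      X : Matrix n q
      X k = proj₁ (w-gen (v k))
      Y : Matrix q n
      Y = coord ∘ w
      XY≈I : IsIdentity (X ⊗ Y)
      XY≈I k = independent⇒lincomb-injective (proj₁ v-basis) (begin
        lincomb (λ k′ → (X ⊗ Y) k k′) v          ≈⟨ lincomb-lincomb (X k) Y v ⟨
        lincomb (X k) (λ i → lincomb (Y i) v)    ≈⟨ lincomb-cong (λ _ → K.refl) (expand ∘ w) ⟨
        lincomb (X k) w                          ≈⟨ proj₂ (w-gen (v k)) ⟨
        v k                                      ≈⟨ lincomb-δ k v ⟨
        lincomb (δ k) v                          ∎)

  lincomb≈0⇒expressible : ∀ {m} {r : Fin (suc m) → K.Carrier} {u : Fin (suc m) → Carrier} j {rⱼ⁻¹} →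
                          rⱼ⁻¹ K.* r j K.≈ K.1# → lincomb r u ≈ 0# →
                          u j ≈ lincomb (λ i → K.- rⱼ⁻¹ K.* removeAt r j i) (removeAt u j)
  lincomb≈0⇒expressible {r = r} {u} j {rⱼ⁻¹} rⱼ⁻¹*rⱼ≈1 ru≈0 = begin
    u j                     ≈⟨ ·-identity (u j) ⟨
    K.1# · u j              ≈⟨ ·-cong rⱼ⁻¹*rⱼ≈1 refl ⟨
    (rⱼ⁻¹ K.* r j) · u j    ≈⟨ ·-assoc rⱼ⁻¹ (r j) (u j) ⟩
    rⱼ⁻¹ · (r j · u j)      ≈⟨ ·-cong K.refl rⱼuⱼ≈-rest ⟩
    rⱼ⁻¹ · (- rest)         ≈⟨ ·-negʳ rⱼ⁻¹ rest ⟩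
    - (rⱼ⁻¹ · rest)         ≈⟨ ·-negˡ rⱼ⁻¹ rest ⟨
    (K.- rⱼ⁻¹) · rest       ≈⟨ lincomb-scale (K.- rⱼ⁻¹) (removeAt r j) (removeAt u j) ⟩
    lincomb (λ i → K.- rⱼ⁻¹ K.* removeAt r j i) (removeAt u j) ∎
    where
      rest = lincomb (removeAt r j) (removeAt u j)
      rⱼuⱼ≈-rest : r j · u j ≈ - rest
      rⱼuⱼ≈-rest = +-inverseˡ-unique _ _ (trans (sym (lincomb-remove r u j)) ru≈0)

  generates-removeAt : ∀ {m} {u : Fin (suc m) → Carrier} j {d : Fin m → K.Carrier} →
                       u j ≈ lincomb d (removeAt u j) → Generates u → Generates (removeAt u j)
  generates-removeAt {u = u} j {d} uⱼ≈du′ u-gen x = (λ i → α j K.* d i K.+ removeAt α j i) , (begin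
    x                                                              ≈⟨ proj₂ (u-gen x) ⟩
    lincomb α u                                                    ≈⟨ lincomb-remove α u j ⟩
    α j · u j + lincomb (removeAt α j) u′                          ≈⟨ +-congʳ (·-cong K.refl uⱼ≈du′) ⟩
    α j · lincomb d u′ + lincomb (removeAt α j) u′                 ≈⟨ +-congʳ (lincomb-scale (α j) d u′) ⟩
    lincomb (λ i → α j K.* d i) u′ + lincomb (removeAt α j) u′     ≈⟨ lincomb-+ _ (removeAt α j) u′ ⟩
    lincomb (λ i → α j K.* d i K.+ removeAt α j i) u′              ∎)
    where
      α = proj₁ (u-gen x)
      u′ = removeAt u j

  generating⇒¬¬independent : ∀ {n} → HasDimension n → (e : Fin n → Carrier) → Generates e →
                             ∀ r → lincomb r e ≈ 0# → ∀ j → ¬ ¬ r j K.≈ K.0#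
  generating⇒¬¬independent {suc n} dim e e-gen r re≈0 j rⱼ≉0 =
    no-smaller-generating-family dim (n<1+n n) (removeAt e j)
      (generates-removeAt {u = e} j (lincomb≈0⇒expressible {r = r} {e} j rⱼ⁻¹*rⱼ≈1 re≈0) e-gen)
    where
      rⱼ⁻¹*rⱼ≈1 = K.trans (K.*-comm _ (r j)) (proj₂ (K.inverse (r j) rⱼ≉0))

  generating⇒dual-coordinates : ∀ {n} → HasDimension n → (e : Fin n → Carrier) → Generates e →
                                Σ[ C ∈ Coordinates e ] (∀ γ i → Coordinates.coord C (lincomb γ e) i K.≈ γ i)
  generating⇒dual-coordinates {n} dim@(v , v-basis) e e-gen = C , coord-lincomb
    where
      C = coordinates-of-generating (basis⇒coordinates v-basis) e-gen
      open Coordinates C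

      Q : Matrix n n
      Q j i = coord (e j) i

      relation : Fin n → Fin n → K.Carrier
      relation l j = δ l j K.- Q l j

      relation-vanishes : ∀ l → lincomb (relation l) e ≈ 0#
      relation-vanishes l = trans (sym (lincomb-sub (δ l) (Q l) e))
                                  (x≈y⇒x∙y⁻¹≈ε (trans (lincomb-δ l e) (expand (e l))))

      ¬¬Q≈I : ¬ ¬ IsIdentity Q
      ¬¬Q≈I = ¬¬-∀ λ l → ¬¬-∀ λ j → ¬¬-map (λ δ-Q≈0 → K.sym (KP.x∙y⁻¹≈ε⇒x≈y _ _ δ-Q≈0))
                (generating⇒¬¬independent dim e e-gen (relation l) (relation-vanishes l) j)

      relation-Q≈0 : ∀ l i → dot (relation l) (λ j → Q j i) K.≈ K.0#
      relation-Q≈0 l i = K.trans (K.sym (linear-lincomb (coord-linear i) (relation l) e))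
                                 (K.trans (cong (coord-linear i) (relation-vanishes l)) (linear-0 (coord-linear i)))

      Q≈I : IsIdentity Q
      Q≈I l j = K.sym (KP.x∙y⁻¹≈ε⇒x≈y _ _ (¬¬identity⇒injective Q ¬¬Q≈I (relation l) (relation-Q≈0 l) j))

      coord-lincomb : ∀ γ i → coord (lincomb γ e) i K.≈ γ i
      coord-lincomb γ i = K.trans (linear-lincomb (coord-linear i) γ e)
        (K.trans (ΣK.sum-cong-≋ λ j → K.*-congˡ (K.trans (Q≈I j i) (δ-sym j i))) (dot-δ γ i))

  dual-coordinates⇒independent : ∀ {n} {e : Fin n → Carrier} (C : Coordinates e) →
                                 (∀ γ i → Coordinates.coord C (lincomb γ e) i K.≈ γ i) → LinearlyIndependent e
  dual-coordinates⇒independent C coord-lincomb γ γe≈0 i =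
    K.trans (K.sym (coord-lincomb γ i)) (K.trans (cong (coord-linear i) γe≈0) (linear-0 (coord-linear i)))
    where open Coordinates C

  spanned⇒generates : ∀ {p n} {S : Pred Carrier p} → Spans S → (e : Fin n → Carrier) →
                      (γ : Σ Carrier S → Fin n → K.Carrier) → (∀ s → proj₁ s ≈ lincomb (γ s) e) → Generates e
  spanned⇒generates S-spans e γ s≈γe x with S-spans x
  ... | _ , α , s , s∈S , x≈αs = (λ i → dot α (λ l → γ′ l i)) , (begin
    x                                       ≈⟨ x≈αs ⟩
    lincomb α s                             ≈⟨ lincomb-cong (λ _ → K.refl) (λ l → s≈γe (s l , s∈S l)) ⟩
    lincomb α (λ l → lincomb (γ′ l) e)      ≈⟨ lincomb-lincomb α γ′ e ⟩
    lincomb (λ i → dot α (λ l → γ′ l i)) e  ∎)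
    where
      γ′ = λ l → γ (s l , s∈S l)

module Characters {c ℓ a ℓa} {F : Field c ℓ} (A : Algebra F a ℓa) where
  open Algebra A hiding (zero)
  open AlgebraNotions A
  open LinearAlgebra A
  open IsLinear
  open Matrices F using (dot; δ; δ-diagonal)
  open import Relation.Binary.Reasoning.Setoid K.setoid

  module _ {p} {S : Pred Carrier p} (S-spans : Spans S) where

    linear-≈-on-spanning : ∀ {f g} → IsLinear f → IsLinear g → (∀ {s} → S s → f s K.≈ g s) → ∀ x → f x K.≈ g x
    linear-≈-on-spanning {f} {g} f-linear g-linear f≈g x with S-spans x
    ... | _ , α , s , s∈S , x≈αs = begin
      f x              ≈⟨ cong f-linear x≈αs ⟩
      f (lincomb α s)  ≈⟨ linear-lincomb f-linear α s ⟩
      dot α (f ∘ s)    ≈⟨ ΣK.sum-cong-≋ (λ l → K.*-congˡ (f≈g (s∈S l))) ⟩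
      dot α (g ∘ s)    ≈⟨ linear-lincomb g-linear α s ⟨
      g (lincomb α s)  ≈⟨ cong g-linear x≈αs ⟨
      g x              ∎

    multiplicative-on-spanning : ∀ {f} → IsLinear f → (∀ {s t} → S s → S t → f (s * t) K.≈ f s K.* f t) →
                                 ∀ x y → f (x * y) K.≈ f x K.* f y
    multiplicative-on-spanning {f} f-linear f-mul x y = K.trans
      (linear-≈-on-spanning (linear-∘-*ˡ f-linear x) (linear-*ʳ f-linear (f x))
         (λ t∈S → K.trans (multiplicative-on-right t∈S x) (K.*-comm _ _)) y)
      (K.*-comm (f y) (f x))
      where
        multiplicative-on-right : ∀ {t} → S t → ∀ x → f (x * t) K.≈ f x K.* f t
        multiplicative-on-right {t} t∈S = linear-≈-on-spanning (linear-∘-*ʳ f-linear t) (linear-*ʳ f-linear (f t))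
                                            (λ s∈S → f-mul s∈S t∈S)

  multiplicative-linear⇒hom : ∀ {f} → IsLinear f → (∀ x y → f (x * y) K.≈ f x K.* f y) →
                              ∀ u → f u K.≈ K.1# → IsAlgebraHomToK f
  multiplicative-linear⇒hom {f} f-linear f-mul u fu≈1 = record
    { cong  = cong f-linear
    ; +-hom = +-hom f-linear
    ; ·-hom = ·-hom f-linear
    ; *-hom = f-mul
    ; 1-hom = begin
        f 1#            ≈⟨ K.*-identityʳ (f 1#) ⟨
        f 1# K.* K.1#   ≈⟨ K.*-congˡ fu≈1 ⟨
        f 1# K.* f u    ≈⟨ f-mul 1# u ⟨
        f (1# * u)      ≈⟨ cong f-linear (*-identityˡ u) ⟩
        f u             ≈⟨ fu≈1 ⟩
        K.1#            ∎
    }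

  module CharacterExtension {p n} {S : Pred Carrier p} {closed : MulClosed S} (S-spans : Spans S)
         {χ : Fin n → Σ Carrier S → K.Carrier} (χ-character : ∀ i → IsCharacterOf S closed (χ i))
         {e : Fin n → Carrier} (s≈χe : ∀ s → proj₁ s ≈ lincomb (λ i → χ i s) e)
         (C : Coordinates e) (coord-lincomb : ∀ γ i → Coordinates.coord C (lincomb γ e) i K.≈ γ i) where
    open Coordinates C

    coord≈χ : ∀ i (s : Σ Carrier S) → coord (proj₁ s) i K.≈ χ i s
    coord≈χ i s = K.trans (cong (coord-linear i) (s≈χe s)) (coord-lincomb (λ j → χ j s) i)

    coord-multiplicative-on-S : ∀ i {s t} → S s → S t → coord (s * t) i K.≈ coord s i K.* coord t i
    coord-multiplicative-on-S i s∈S t∈S = begin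
      coord (_ * _) i                          ≈⟨ coord≈χ i (_ , closed s∈S t∈S) ⟩
      χ i (_ , closed s∈S t∈S)                 ≈⟨ χ-character i (_ , s∈S) (_ , t∈S) ⟩
      χ i (_ , s∈S) K.* χ i (_ , t∈S)          ≈⟨ K.*-cong (coord≈χ i (_ , s∈S)) (coord≈χ i (_ , t∈S)) ⟨
      coord _ i K.* coord _ i                  ∎

    coord-eᵢ≈1 : ∀ i → coord (e i) i K.≈ K.1#
    coord-eᵢ≈1 i = K.trans (cong (coord-linear i) (sym (lincomb-δ i e))) (K.trans (coord-lincomb (δ i) i) (δ-diagonal i))

    coord-hom : IsAlgebraHomToKⁿ coord
    coord-hom i = multiplicative-linear⇒hom (coord-linear i)
      (multiplicative-on-spanning S-spans (coord-linear i) (coord-multiplicative-on-S i)) (e i) (coord-eᵢ≈1 i)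

proposition2p1 : ∀ {c ℓ a ℓa p : Level} (F : Field c ℓ) (A : Algebra F a ℓa) (n : ℕ) →
  let open Algebra A
      open AlgebraNotions A
  in
  HasDimension n →
  (S : Pred Carrier p) → (closed : MulClosed S) → Spans S →
  (χ : Fin n → Σ Carrier S → K.Carrier) → (∀ i → IsCharacterOf S closed (χ i)) →
  (e : Fin n → Carrier) →
  (∀ (s : Σ Carrier S) → proj₁ s ≈ lincomb (λ i → χ i s) e) →
  IsBasis e
  × (Σ[ φ ∈ (Carrier → Fin n → K.Carrier) ]
      (IsAlgebraHomToKⁿ φ × InjectiveKⁿ φ
        × (∀ (coeff : Fin n → K.Carrier) i → φ (lincomb coeff e) i K.≈ coeff i)))
  × (∀ i → Σ[ ψ ∈ (Carrier → K.Carrier) ]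
      (IsAlgebraHomToK ψ × (∀ (s : Σ Carrier S) → ψ (proj₁ s) K.≈ χ i s)))
proposition2p1 F A n dim S closed S-spans χ χ-character e s≈χe =
    (dual-coordinates⇒independent C coord-lincomb , e-generates)
  , (coord , coord-hom , coord-injective , coord-lincomb)
  , λ i → (λ x → coord x i) , coord-hom i , coord≈χ i
  where
    open AlgebraNotions A
    open LinearAlgebra A
    open Characters A

    e-generates : Generates e
    e-generates = spanned⇒generates S-spans e (λ s i → χ i s) s≈χe

    C = proj₁ (generating⇒dual-coordinates dim e e-generates)
    coord-lincomb = proj₂ (generating⇒dual-coordinates dim e e-generates)
    open Coordinates C
    open CharacterExtension S-spans χ-character s≈χe C coord-lincomb
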